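{- Let $2\le k\le n-1$ be integers and let $X=\{x_1,\dots,x_{k-1}\}\in\binom{[n]}{k-1}$ with $x_1<\dots<x_{k-1}$ and $n\notin X$. Set $x_k:=n$. Then the set $V_X:=\{A\in\binom{[n]}{k}: A_s\le X\le A_t\}$ satisfies \[ |V_X| = x_1\sum_{i=1}^{k}\binom{n-x_i}{k-i}-\sum_{i=1}^{k-1}\binom{n-x_{i+1}+1}{k-i}. \]
   Context: $[n]=\{1,\dots,n\}$ and $\binom{[n]}{r}$ is the set of $r$-subsets of $[n]$. An $r$-subset is written $\{a_1,\dots,a_r\}$ with $a_1<\dots<a_r$, and for $r$-subsets $X,Y$ we write $X\le Y$ if their increasing tuples satisfy $(x_1,\dots,x_r)\le(y_1,\dots,y_r)$ lexicographically. For $A=\{a_1,\dots,a_k\}\in\binom{[n]}{k}$, $A_s=\{a_1,\dots,a_{k-1}\}$ and $A_t=\{a_2,\dots,a_k\}$. -}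

module Defs where

open import Data.Nat using (ℕ; zero; suc; _+_; _*_; _∸_; _≤_; _<_)
open import Data.Nat.Combinatorics using (_C_)
open import Data.Nat.ListAction using (sum)
open import Data.List using (List; []; _∷_; length; take; drop; map; upTo; _++_; [_])
open import Data.List.Relation.Unary.All using (All)
open import Data.List.Relation.Unary.Linked using (Linked)
open import Data.List.Relation.Binary.Lex.Core using (Lex-≤)
open import Data.Product using (_×_)
open import Relation.Binary.PropositionalEquality using (_≡_)

IsSubsetOf : ℕ → ℕ → List ℕ → Set
IsSubsetOf n r A = (length A ≡ r) × Linked _<_ A × All (λ a → 1 ≤ a × a ≤ n) A

_≤lex_ : List ℕ → List ℕ → Set
X ≤lex Y = Lex-≤ _≡_ _<_ X Y

_ₛ : List ℕ → List ℕ
A ₛ = take (length A ∸ 1) A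

_ₜ : List ℕ → List ℕ
A ₜ = drop 1 A

InV : ℕ → ℕ → List ℕ → List ℕ → Set
InV n k X A = IsSubsetOf n k A × ((A ₛ) ≤lex X) × (X ≤lex (A ₜ))

-- 1-indexed entry of a list (default 0 out of range): nth L 1 = first entry
nth : List ℕ → ℕ → ℕ
nth [] _ = 0
nth (x ∷ xs) zero = 0
nth (x ∷ xs) (suc zero) = x
nth (x ∷ xs) (suc (suc i)) = nth xs (suc i)

sumFrom1 : ℕ → (ℕ → ℕ) → ℕ
sumFrom1 m f = sum (map (λ i → f (suc i)) (upTo m))

xs : ℕ → List ℕ → ℕ → ℕ
xs n X i = nth (X ++ [ n ]) i

positivePart : ℕ → ℕ → List ℕ → ℕ
positivePart n k X = xs n X 1 * sumFrom1 k (λ i → (n ∸ xs n X i) C (k ∸ i))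

negativePart : ℕ → ℕ → List ℕ → ℕ
negativePart n k X = sumFrom1 (k ∸ 1) (λ i → (n ∸ xs n X (suc i) + 1) C (k ∸ i))

-- Write X = x ∷ X′ and let U be the number of (k−1)-sets B with X ≤lex B; splitting on the first
-- position where B exceeds X gives U = Σᵢ C(n − xᵢ, k − i). A set A ∈ V_X either starts with some
-- a < x, and then A_s ≤lex X holds automatically while A_t ranges over those B, or A = x ∷ B with
-- B_s ≤lex X′. Splitting the latter B by the first entry that falls below its counterpart in X′,
-- the blocks are sums of binomials which the hockey-stick identity collapses: their number plus
-- the negative part telescopes to C(n − x, k − 1) + Σ_{i≥2} C(n − xᵢ, k − i) = U.
-- Hence |V_X| + negative part = (x − 1)U + U = x U.
module Submission where

open import Defs
open import Data.Nat using (ℕ; zero; suc; _+_; _*_; _∸_; _≤_; _<_; z≤n; s≤s)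
open import Data.Nat.Properties
open import Data.Nat.Combinatorics using (_C_; nCk+nC[k+1]≡[n+1]C[k+1])
open import Data.Nat.ListAction using (sum)
open import Data.List using (List; []; _∷_; length; map; _++_; [_])
open import Data.List.Properties using (length-map; length-++; ∷-injectiveˡ; ∷-injectiveʳ; map-applyUpTo)
open import Data.List.Membership.Propositional using (_∈_; _∉_)
open import Data.List.Membership.Propositional.Properties using (∈-map⁺; ∈-map⁻; ∈-++⁺ˡ; ∈-++⁺ʳ; ∈-++⁻)
open import Data.List.Relation.Unary.All as All using (All; []; _∷_)
open import Data.List.Relation.Unary.Any using (here; there)
open import Data.List.Relation.Unary.AllPairs using ([]; _∷_)
open import Data.List.Relation.Unary.Linked using (Linked; []; [-]; _∷_)
open import Data.List.Relation.Unary.Linked.Properties using (Linked⇒All)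
open import Data.List.Relation.Unary.Unique.Propositional using (Unique)
open import Data.List.Relation.Unary.Unique.Propositional.Properties using (map⁺; ++⁺)
open import Data.List.Relation.Binary.Lex.Core using (base; this; next)
open import Data.Product using (Σ; ∃; _×_; _,_; proj₂)
open import Data.Sum using (inj₁; inj₂)
open import Data.Empty using (⊥; ⊥-elim)
open import Data.Unit using (tt)
open import Function using (_∘_; id; const)
open import Function.Bundles using (_⇔_; mk⇔; Equivalence)
open import Function.Definitions using (Injective)
open import Level using (0ℓ)
open import Algebra.Properties.CommutativeSemigroup +-commutativeSemigroup using (interchange)
open import Relation.Binary.PropositionalEquality using (_≡_; refl; sym; trans; cong; cong₂; subst; module ≡-Reasoning)
open import Relation.Unary using (Pred; _∪_; _⊆_; _≐_; Empty)

record Enumeration {A : Set} (P : Pred A 0ℓ) (c : ℕ) : Set where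
  field
    elements : List A
    unique   : Unique elements
    members  : ∀ a → a ∈ elements ⇔ P a
    length≡  : length elements ≡ c

Image : {A B : Set} → (A → B) → Pred A 0ℓ → Pred B 0ℓ
Image f P b = ∃ λ a → b ≡ f a × P a

private variable
  A B : Set
  P Q : Pred A 0ℓ
  c c₁ c₂ : ℕ

recount : c₁ ≡ c₂ → Enumeration P c₁ → Enumeration P c₂
recount refl E = E

resp-≐ : P ≐ Q → Enumeration P c → Enumeration Q c
resp-≐ (P⊆Q , Q⊆P) E = record
  { elements = elements
  ; unique   = unique
  ; members  = λ a → mk⇔ (P⊆Q ∘ Equivalence.to (members a)) (Equivalence.from (members a) ∘ Q⊆P)
  ; length≡  = length≡
  }
  where open Enumeration E

none : Empty P → Enumeration P 0
none ∅ = record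
  { elements = [] ; unique = [] ; members = λ a → mk⇔ (λ ()) (⊥-elim ∘ ∅ a) ; length≡ = refl }

singleton : (a : A) → Enumeration (_≡ a) 1
singleton a = record
  { elements = [ a ]
  ; unique   = [] ∷ []
  ; members  = λ b → mk⇔ (λ { (here b≡a) → b≡a ; (there ()) }) here
  ; length≡  = refl
  }

image : (f : A → B) → Injective _≡_ _≡_ f → Enumeration P c → Enumeration (Image f P) c
image {P = P} f f-inj E = record
  { elements = map f elements
  ; unique   = map⁺ f-inj unique
  ; members  = λ b → mk⇔ to from
  ; length≡  = trans (length-map f elements) length≡
  }
  where
  open Enumeration E
  to : ∀ {b} → b ∈ map f elements → Image f P b
  to b∈ with ∈-map⁻ f b∈
  ... | a , a∈ , refl = a , refl , Equivalence.to (members a) a∈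
  from : ∀ {b} → Image f P b → b ∈ map f elements
  from (a , refl , p) = ∈-map⁺ f (Equivalence.from (members a) p)

union : (∀ {a} → P a → Q a → ⊥) →
  Enumeration P c₁ → Enumeration Q c₂ → Enumeration (P ∪ Q) (c₁ + c₂)
union {P = P} {Q = Q} disjoint E F = record
  { elements = E.elements ++ F.elements
  ; unique   = ++⁺ E.unique F.unique λ (e , f) →
                 disjoint (Equivalence.to (E.members _) e) (Equivalence.to (F.members _) f)
  ; members  = λ a → mk⇔ to from
  ; length≡  = trans (length-++ E.elements) (cong₂ _+_ E.length≡ F.length≡)
  }
  where
  module E = Enumeration E
  module F = Enumeration F
  to : ∀ {a} → a ∈ E.elements ++ F.elements → (P ∪ Q) a
  to {a} a∈ with ∈-++⁻ E.elements a∈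
  ... | inj₁ e = inj₁ (Equivalence.to (E.members a) e)
  ... | inj₂ f = inj₂ (Equivalence.to (F.members a) f)
  from : ∀ {a} → (P ∪ Q) a → a ∈ E.elements ++ F.elements
  from {a} (inj₁ p) = ∈-++⁺ˡ (Equivalence.from (E.members a) p)
  from {a} (inj₂ q) = ∈-++⁺ʳ E.elements (Equivalence.from (F.members a) q)

∑-after : (ℕ → ℕ) → ℕ → ℕ → ℕ
∑-after f lo zero    = 0
∑-after f lo (suc d) = f (suc lo) + ∑-after f (suc lo) d

∑-after-const : ∀ g lo d → ∑-after (const g) lo d ≡ d * g
∑-after-const g lo zero    = refl
∑-after-const g lo (suc d) = cong (g +_) (∑-after-const g (suc lo) d)

hockey-stick : ∀ n m lo d → lo + d ≤ n →
  ∑-after (λ b → (n ∸ b) C m) lo d + (n ∸ (lo + d)) C suc m ≡ (n ∸ lo) C suc m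
hockey-stick n m lo zero    _         rewrite +-identityʳ lo = refl
hockey-stick n m lo (suc d) lo+[1+d]≤n = begin
  (n ∸ suc lo) C m + ∑-after f (suc lo) d + (n ∸ (lo + suc d)) C suc m
    ≡⟨ cong (λ e → (n ∸ suc lo) C m + ∑-after f (suc lo) d + (n ∸ e) C suc m) (+-suc lo d) ⟩
  (n ∸ suc lo) C m + ∑-after f (suc lo) d + (n ∸ (suc lo + d)) C suc m
    ≡⟨ +-assoc ((n ∸ suc lo) C m) _ _ ⟩
  (n ∸ suc lo) C m + (∑-after f (suc lo) d + (n ∸ (suc lo + d)) C suc m)
    ≡⟨ cong ((n ∸ suc lo) C m +_) (hockey-stick n m (suc lo) d 1+lo+d≤n) ⟩
  (n ∸ suc lo) C m + (n ∸ suc lo) C suc m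
    ≡⟨ nCk+nC[k+1]≡[n+1]C[k+1] (n ∸ suc lo) m ⟩
  suc (n ∸ suc lo) C suc m
    ≡⟨ cong (_C suc m) (sym (+-∸-assoc 1 (m+n≤o⇒m≤o (suc lo) 1+lo+d≤n))) ⟩
  (n ∸ lo) C suc m ∎
  where
  open ≡-Reasoning
  f : ℕ → ℕ
  f b = (n ∸ b) C m
  1+lo+d≤n : suc lo + d ≤ n
  1+lo+d≤n = subst (_≤ n) (+-suc lo d) lo+[1+d]≤n

Between : ℕ → ℕ → (ℕ → Pred A 0ℓ) → Pred A 0ℓ
Between lo hi P a = ∃ λ b → lo < b × b < hi × P b a

between : {P : ℕ → Pred A 0ℓ} {lo hi : ℕ} (count : ℕ → ℕ) →
  (∀ {b b′ a} → P b a → P b′ a → b ≡ b′) →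
  (∀ b → b < hi → Enumeration (P b) (count b)) →
  lo < hi → Enumeration (Between lo hi P) (∑-after count lo (hi ∸ suc lo))
between {P = P} {lo} {hi} count separated enum lo<hi = go (hi ∸ suc lo) lo (m∸n+n≡m lo<hi)
  where
  go : ∀ d lo → d + suc lo ≡ hi → Enumeration (Between lo hi P) (∑-after count lo d)
  go zero    lo refl = none λ a (b , lo<b , b<1+lo , _) → <⇒≱ lo<b (m<1+n⇒m≤n b<1+lo)
  go (suc d) lo eq   = resp-≐ (merge , split) (union disjoint (enum (suc lo) 1+lo<hi) (go d (suc lo) eq′))
    where
    eq′ : d + suc (suc lo) ≡ hi
    eq′ = trans (+-suc d (suc lo)) eq
    1+lo<hi : suc lo < hi
    1+lo<hi = subst (suc lo <_) eq (s≤s (m≤n+m (suc lo) d))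
    disjoint : ∀ {a} → P (suc lo) a → Between (suc lo) hi P a → ⊥
    disjoint p (b , 1+lo<b , _ , p′) = <-irrefl (separated p p′) 1+lo<b
    merge : P (suc lo) ∪ Between (suc lo) hi P ⊆ Between lo hi P
    merge (inj₁ p)                        = suc lo , ≤-refl , 1+lo<hi , p
    merge (inj₂ (b , 1+lo<b , b<hi , p)) = b , <-trans (n<1+n lo) 1+lo<b , b<hi , p
    split : Between lo hi P ⊆ P (suc lo) ∪ Between (suc lo) hi P
    split (b , lo<b , b<hi , p) with m≤n⇒m<n∨m≡n lo<b
    ... | inj₁ 1+lo<b = inj₂ (b , 1+lo<b , b<hi , p)
    ... | inj₂ refl   = inj₁ p

sumFrom1-suc : ∀ m f → sumFrom1 (suc m) f ≡ f 1 + sumFrom1 m (f ∘ suc)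
sumFrom1-suc m f = cong (f 1 +_) (cong sum
  (trans (map-applyUpTo suc (f ∘ suc) m) (sym (map-applyUpTo id (f ∘ suc ∘ suc) m))))

head-unique : {P : ℕ → Pred (List ℕ) 0ℓ} {b b′ : ℕ} {B : List ℕ} →
  Image (b ∷_) (P b) B → Image (b′ ∷_) (P b′) B → b ≡ b′
head-unique (_ , refl , _) (_ , eq , _) = ∷-injectiveˡ eq

m∸n≡m∸[1+n]+1 : ∀ {m n} → n < m → m ∸ n ≡ m ∸ suc n + 1
m∸n≡m∸[1+n]+1 {m} {n} n<m = trans (+-∸-assoc 1 n<m) (+-comm 1 (m ∸ suc n))

module Counting (n : ℕ) where

  Ascending : ℕ → List ℕ → Set
  Ascending lo B = Linked _<_ (lo ∷ B) × All (_≤ n) B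

  SubsetAbove : ℕ → ℕ → Pred (List ℕ) 0ℓ
  SubsetAbove lo m B = length B ≡ m × Ascending lo B

  enumSubsetAbove : ∀ lo m → lo ≤ n → Enumeration (SubsetAbove lo m) ((n ∸ lo) C m)
  enumSubsetAbove lo m lo≤n = go (n ∸ lo) lo m (m∸n+n≡m lo≤n)
    where
    go : ∀ d lo m → d + lo ≡ n → Enumeration (SubsetAbove lo m) (d C m)
    go d lo zero _ = resp-≐ ((λ { refl → refl , [-] , [] }) , λ { {[]} _ → refl }) (singleton [])
    go zero lo (suc m) refl = none λ { (b ∷ _) (_ , lo<b ∷ _ , b≤lo ∷ _) → <⇒≱ lo<b b≤lo }
    go (suc d) lo (suc m) eq =
      recount (nCk+nC[k+1]≡[n+1]C[k+1] d m)
        (resp-≐ (merge , split)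
          (union disjoint (image (suc lo ∷_) ∷-injectiveʳ (go d (suc lo) m eq′)) (go d (suc lo) (suc m) eq′)))
      where
      eq′ : d + suc lo ≡ n
      eq′ = trans (+-suc d lo) eq
      1+lo≤n : suc lo ≤ n
      1+lo≤n = subst (suc lo ≤_) eq (s≤s (m≤n+m lo d))
      disjoint : ∀ {B} → Image (suc lo ∷_) (SubsetAbove (suc lo) m) B → SubsetAbove (suc lo) (suc m) B → ⊥
      disjoint (_ , refl , _) (_ , 1+lo<1+lo ∷ _ , _) = <-irrefl refl 1+lo<1+lo
      merge : Image (suc lo ∷_) (SubsetAbove (suc lo) m) ∪ SubsetAbove (suc lo) (suc m) ⊆ SubsetAbove lo (suc m)
      merge (inj₁ (_ , refl , l , lk , al))        = cong suc l , ≤-refl ∷ lk , 1+lo≤n ∷ al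
      merge {_ ∷ _} (inj₂ (l , 1+lo<b ∷ lk , al)) = l , <-trans (n<1+n lo) 1+lo<b ∷ lk , al
      split : SubsetAbove lo (suc m) ⊆ Image (suc lo ∷_) (SubsetAbove (suc lo) m) ∪ SubsetAbove (suc lo) (suc m)
      split {b ∷ B} (l , lo<b ∷ lk , b≤n ∷ al) with m≤n⇒m<n∨m≡n lo<b
      ... | inj₁ 1+lo<b = inj₂ (l , 1+lo<b ∷ lk , b≤n ∷ al)
      ... | inj₂ refl   = inj₁ (B , refl , suc-injective l , lk , al)

  Upper : List ℕ → ℕ → Pred (List ℕ) 0ℓ
  Upper Y lo B = SubsetAbove lo (length Y) B × Y ≤lex B

  -- Σ_{i ≤ |Y|+1} C(n − yᵢ, |Y| + 1 − i) with y_{|Y|+1} = n, the paper's convention x_k = n.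
  #Upper : List ℕ → ℕ
  #Upper []      = 1
  #Upper (y ∷ Y) = (n ∸ y) C suc (length Y) + #Upper Y

  enumUpper : ∀ Y lo → Ascending lo Y → Enumeration (Upper Y lo) (#Upper Y)
  enumUpper [] lo _ = resp-≐ ((λ { refl → (refl , [-] , []) , base tt }) , λ { {[]} _ → refl }) (singleton [])
  enumUpper (y ∷ Y) lo (lo<y ∷ y<Y , y≤n ∷ Y≤n) =
    resp-≐ (merge , split)
      (union disjoint (enumSubsetAbove y (suc (length Y)) y≤n)
                      (image (y ∷_) ∷-injectiveʳ (enumUpper Y y (y<Y , Y≤n))))
    where
    disjoint : ∀ {B} → SubsetAbove y (suc (length Y)) B → Image (y ∷_) (Upper Y y) B → ⊥
    disjoint (_ , y<y ∷ _ , _) (_ , refl , _) = <-irrefl refl y<y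
    merge : SubsetAbove y (suc (length Y)) ∪ Image (y ∷_) (Upper Y y) ⊆ Upper (y ∷ Y) lo
    merge {_ ∷ _} (inj₁ (l , y<b ∷ lk , al))       = (l , <-trans lo<y y<b ∷ lk , al) , this y<b
    merge (inj₂ (_ , refl , (l , lk , al) , Y≤B)) = (cong suc l , lo<y ∷ lk , y≤n ∷ al) , next refl Y≤B
    split : Upper (y ∷ Y) lo ⊆ SubsetAbove y (suc (length Y)) ∪ Image (y ∷_) (Upper Y y)
    split {_ ∷ _} ((l , _ ∷ lk , al) , this y<b)         = inj₁ (l , y<b ∷ lk , al)
    split {_ ∷ B} ((l , _ ∷ lk , _ ∷ al) , next refl Y≤B) =
      inj₂ (B , refl , (suc-injective l , lk , al) , Y≤B)

  Lower : List ℕ → ℕ → Pred (List ℕ) 0ℓ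
  Lower Y lo B = SubsetAbove lo (suc (length Y)) B × (B ₛ) ≤lex Y

  #Lower : List ℕ → ℕ → ℕ
  #Lower []      lo = (n ∸ lo) C 1
  #Lower (y ∷ Y) lo = ∑-after (λ b → (n ∸ b) C suc (length Y)) lo (y ∸ suc lo) + #Lower Y y

  enumLower : ∀ Y lo → lo ≤ n → Ascending lo Y → Enumeration (Lower Y lo) (#Lower Y lo)
  enumLower [] lo lo≤n _ = resp-≐ (to , λ (s , _) → s) (enumSubsetAbove lo 1 lo≤n)
    where
    to : SubsetAbove lo 1 ⊆ Lower [] lo
    to {_ ∷ []}    s       = s , base tt
    to {[]}        (() , _)
    to {_ ∷ _ ∷ _} (() , _)
  enumLower (y ∷ Y) lo _ (lo<y ∷ y<Y , y≤n ∷ Y≤n) =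
    resp-≐ (merge , split)
      (union disjoint
        (between (λ b → (n ∸ b) C suc (length Y)) head-unique
          (λ b b<y → image (b ∷_) ∷-injectiveʳ
                       (enumSubsetAbove b (suc (length Y)) (≤-trans (<⇒≤ b<y) y≤n)))
          lo<y)
        (image (y ∷_) ∷-injectiveʳ (enumLower Y y y≤n (y<Y , Y≤n))))
    where
    Start : Pred (List ℕ) 0ℓ
    Start = Between lo y (λ b → Image (b ∷_) (SubsetAbove b (suc (length Y))))
    disjoint : ∀ {B} → Start B → Image (y ∷_) (Lower Y y) B → ⊥
    disjoint (_ , _ , y<y , _ , refl , _) (_ , refl , _) = <-irrefl refl y<y
    merge : Start ∪ Image (y ∷_) (Lower Y y) ⊆ Lower (y ∷ Y) lo
    merge (inj₁ (b , lo<b , b<y , _ ∷ _ , refl , l , lk , al)) =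
      (cong suc l , lo<b ∷ lk , ≤-trans (<⇒≤ b<y) y≤n ∷ al) , this b<y
    merge (inj₂ (_ ∷ _ , refl , (l , lk , al) , Bₛ≤Y)) =
      (cong suc l , lo<y ∷ lk , y≤n ∷ al) , next refl Bₛ≤Y
    split : Lower (y ∷ Y) lo ⊆ Start ∪ Image (y ∷_) (Lower Y y)
    split {_ ∷ []} ((() , _) , _)
    split {b ∷ B@(_ ∷ _)} ((l , lo<b ∷ lk , _ ∷ al) , this b<y) =
      inj₁ (b , lo<b , b<y , B , refl , suc-injective l , lk , al)
    split {_ ∷ B@(_ ∷ _)} ((l , _ ∷ lk , _ ∷ al) , next refl Bₛ≤Y) =
      inj₂ (B , refl , (suc-injective l , lk , al) , Bₛ≤Y)

  V : ℕ → List ℕ → Pred (List ℕ) 0ℓ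
  V lo X A = SubsetAbove lo (suc (length X)) A × (A ₛ) ≤lex X × X ≤lex (A ₜ)

  enumV : ∀ lo x X → Ascending lo (x ∷ X) →
    Enumeration (V lo (x ∷ X)) ((x ∸ suc lo) * #Upper (x ∷ X) + #Lower X x)
  enumV lo x X (lo<x ∷ x<X , x≤n ∷ X≤n) =
    resp-≐ (merge , split)
      (union disjoint
        (recount (∑-after-const (#Upper (x ∷ X)) lo (x ∸ suc lo))
          (between (const (#Upper (x ∷ X))) head-unique
            (λ a a<x → image (a ∷_) ∷-injectiveʳ (enumUpper (x ∷ X) a (a<x ∷ x<X , x≤n ∷ X≤n))) lo<x))
        (image (x ∷_) ∷-injectiveʳ (enumLower X x x≤n (x<X , X≤n))))
    where
    Start : Pred (List ℕ) 0ℓ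
    Start = Between lo x (λ a → Image (a ∷_) (Upper (x ∷ X) a))
    disjoint : ∀ {A} → Start A → Image (x ∷_) (Lower X x) A → ⊥
    disjoint (_ , _ , x<x , _ , refl , _) (_ , refl , _) = <-irrefl refl x<x
    merge : Start ∪ Image (x ∷_) (Lower X x) ⊆ V lo (x ∷ X)
    merge (inj₁ (a , lo<a , a<x , _ ∷ _ , refl , (l , lk , al) , X≤B)) =
      (cong suc l , lo<a ∷ lk , ≤-trans (<⇒≤ a<x) x≤n ∷ al) , this a<x , X≤B
    merge (inj₂ (_ ∷ _ , refl , (l , x<b ∷ lk , al) , Bₛ≤X)) =
      (cong suc l , lo<x ∷ x<b ∷ lk , x≤n ∷ al) , next refl Bₛ≤X , this x<b
    split : V lo (x ∷ X) ⊆ Start ∪ Image (x ∷_) (Lower X x)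
    split {_ ∷ []} ((() , _) , _)
    split {a ∷ B@(_ ∷ _)} ((l , lo<a ∷ lk , _ ∷ al) , this a<x , X≤B) =
      inj₁ (a , lo<a , a<x , B , refl , (suc-injective l , lk , al) , X≤B)
    split {_ ∷ B@(_ ∷ _)} ((l , _ ∷ lk , _ ∷ al) , next refl Bₛ≤X , _) =
      inj₂ (B , refl , (suc-injective l , lk , al) , Bₛ≤X)

  negativeSum : List ℕ → ℕ
  negativeSum []      = 1
  negativeSum (y ∷ Y) = (n ∸ y + 1) C suc (suc (length Y)) + negativeSum Y

  #Lower+negativeSum : ∀ Y lo → Ascending lo Y →
    #Lower Y lo + negativeSum Y ≡ (n ∸ lo) C suc (length Y) + #Upper Y
  #Lower+negativeSum []      lo _ = refl
  #Lower+negativeSum (y ∷ Y) lo (lo<y ∷ y<Y , y≤n ∷ Y≤n) = begin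
    (∑-after f lo d + #Lower Y y) + ((n ∸ y + 1) C suc m + negativeSum Y)
      ≡⟨ interchange (∑-after f lo d) _ _ _ ⟩
    (∑-after f lo d + (n ∸ y + 1) C suc m) + (#Lower Y y + negativeSum Y)
      ≡⟨ cong₂ _+_ telescope (#Lower+negativeSum Y y (y<Y , Y≤n)) ⟩
    (n ∸ lo) C suc m + ((n ∸ y) C m + #Upper Y) ∎
    where
    open ≡-Reasoning
    m d : ℕ
    m = suc (length Y)
    d = y ∸ suc lo
    f : ℕ → ℕ
    f b = (n ∸ b) C m
    1+lo+d≡y : suc (lo + d) ≡ y
    1+lo+d≡y = m+[n∸m]≡n lo<y
    telescope : ∑-after f lo d + (n ∸ y + 1) C suc m ≡ (n ∸ lo) C suc m
    telescope = begin
      ∑-after f lo d + (n ∸ y + 1) C suc m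
        ≡⟨ cong (λ e → ∑-after f lo d + (n ∸ e + 1) C suc m) (sym 1+lo+d≡y) ⟩
      ∑-after f lo d + (n ∸ suc (lo + d) + 1) C suc m
        ≡⟨ cong (λ e → ∑-after f lo d + e C suc m) (sym (m∸n≡m∸[1+n]+1 lo+d<n)) ⟩
      ∑-after f lo d + (n ∸ (lo + d)) C suc m
        ≡⟨ hockey-stick n m lo d (<⇒≤ lo+d<n) ⟩
      (n ∸ lo) C suc m ∎
      where
      lo+d<n : lo + d < n
      lo+d<n = subst (_≤ n) (sym 1+lo+d≡y) y≤n

  #V+negativeSum : ∀ lo x X → Ascending lo (x ∷ X) →
    (x ∸ suc lo) * #Upper (x ∷ X) + #Lower X x + negativeSum X ≡ (x ∸ lo) * #Upper (x ∷ X)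
  #V+negativeSum lo x X (lo<x ∷ x<X , _ ∷ X≤n) = begin
    (x ∸ suc lo) * U + #Lower X x + negativeSum X
      ≡⟨ +-assoc ((x ∸ suc lo) * U) _ _ ⟩
    (x ∸ suc lo) * U + (#Lower X x + negativeSum X)
      ≡⟨ cong ((x ∸ suc lo) * U +_) (#Lower+negativeSum X x (x<X , X≤n)) ⟩
    (x ∸ suc lo) * U + U
      ≡⟨ +-comm ((x ∸ suc lo) * U) U ⟩
    suc (x ∸ suc lo) * U
      ≡⟨ cong (_* U) (+-∸-assoc 1 lo<x) ⟨
    (x ∸ lo) * U ∎
    where
    open ≡-Reasoning
    U : ℕ
    U = #Upper (x ∷ X)

  SubsetAbove₀≐IsSubsetOf : ∀ m → SubsetAbove 0 m ≐ IsSubsetOf n m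
  SubsetAbove₀≐IsSubsetOf m = to , from
    where
    to : SubsetAbove 0 m ⊆ IsSubsetOf n m
    to {[]}    (l , _ , _)           = l , [] , []
    to {_ ∷ _} (l , 0<a ∷ lk , al) = l , lk , All.zip (Linked⇒All <-trans 0<a lk , al)
    from : IsSubsetOf n m ⊆ SubsetAbove 0 m
    from {[]}    (l , _ , _)                 = l , [-] , []
    from {_ ∷ _} (l , lk , al@((1≤a , _) ∷ _)) = l , 1≤a ∷ lk , All.map proj₂ al

  V₀≐InV : ∀ X → V 0 X ≐ InV n (suc (length X)) X
  V₀≐InV X =
    let (to , from) = SubsetAbove₀≐IsSubsetOf (suc (length X))
    in (λ (s , lex) → to s , lex) , (λ (s , lex) → from s , lex)

  sumFrom1-binomials≡#Upper : ∀ Y →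
    sumFrom1 (suc (length Y)) (λ i → (n ∸ xs n Y i) C (suc (length Y) ∸ i)) ≡ #Upper Y
  sumFrom1-binomials≡#Upper []      = refl
  sumFrom1-binomials≡#Upper (y ∷ Y) =
    trans (sumFrom1-suc (suc (length Y)) (λ i → (n ∸ xs n (y ∷ Y) i) C (suc (suc (length Y)) ∸ i)))
      (cong ((n ∸ y) C suc (length Y) +_) (sumFrom1-binomials≡#Upper Y))

  positivePart≡ : ∀ x X → positivePart n (suc (suc (length X))) (x ∷ X) ≡ x * #Upper (x ∷ X)
  positivePart≡ x X = cong (x *_) (sumFrom1-binomials≡#Upper (x ∷ X))

  negativePart≡negativeSum : ∀ x X → negativePart n (suc (suc (length X))) (x ∷ X) ≡ negativeSum X
  negativePart≡negativeSum x []      rewrite n∸n≡0 n = refl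
  negativePart≡negativeSum x (y ∷ Y) =
    trans (sumFrom1-suc (suc (length Y))
                        (λ i → (n ∸ xs n (x ∷ y ∷ Y) (suc i) + 1) C (suc (suc (suc (length Y))) ∸ i)))
      (cong ((n ∸ y + 1) C suc (suc (length Y)) +_) (negativePart≡negativeSum y Y))

mainTheorem10 : (n k : ℕ) → 2 ≤ k → k ≤ n ∸ 1 →
    (X : List ℕ) → IsSubsetOf n (k ∸ 1) X → n ∉ X →
    Σ (List (List ℕ)) (λ L → Unique L × (∀ A → (A ∈ L) ⇔ InV n k X A)
      × (length L + negativePart n k X ≡ positivePart n k X))
mainTheorem10 n _ (s≤s (s≤s z≤n)) _ (x ∷ X) X-sub@(refl , _) _ = elements , unique , members , count
  where
  open Counting n
  ascending : Ascending 0 (x ∷ X)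
  ascending = proj₂ (proj₂ (SubsetAbove₀≐IsSubsetOf (suc (length X))) X-sub)
  open Enumeration (resp-≐ (V₀≐InV (x ∷ X)) (enumV 0 x X ascending))
  open ≡-Reasoning
  k : ℕ
  k = suc (suc (length X))
  count : length elements + negativePart n k (x ∷ X) ≡ positivePart n k (x ∷ X)
  count = begin
    length elements + negativePart n k (x ∷ X)
      ≡⟨ cong₂ _+_ length≡ (negativePart≡negativeSum x X) ⟩
    (x ∸ 1) * #Upper (x ∷ X) + #Lower X x + negativeSum X
      ≡⟨ #V+negativeSum 0 x X ascending ⟩
    x * #Upper (x ∷ X)
      ≡⟨ positivePart≡ x X ⟨
    positivePart n k (x ∷ X) ∎
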